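{- For every integer $m\ge1$, every cycle $C$ in $G_m$ satisfies $\operatorname{ch}_{G_m}(C)\le 10$.
   Context: $\operatorname{ch}_{G}(C)$ is the number of edges of $G$ joining two vertices of the cycle $C$ that are not consecutive on $C$. Fix $m\ge1$. Spine blocks $S_0,\dots,S_m$: each $S_i$ is a $5$-cycle with vertices $S_i[a],S_i[b],S_i[c],S_i[d],S_i[e]$ in this cyclic order. Leaf blocks: $L_{0,x}$ for $x\in\{a,b,d,e\}$; $L_{i,x}$ for $1\le i\le m-1$ and $x\in\{b,d,e\}$; $L_{m,x}$ for $x\in\{b,c,d,e\}$. Each $L_{i,x}$ is a $5$-cycle with vertices $L_{i,x}[A],\dots,L_{i,x}[E]$ in this cyclic order. All blocks are vertex-disjoint. For a lowercase letter $x$, $X$ denotes the corresponding uppercase letter. Add edges $S_i[x]L_{i,x}[X]$ for each leaf block $L_{i,x}$, and edges $S_i[c]S_{i+1}[a]$ for $0\le i<m$. Finally add a new vertex $v$ adjacent to the four vertices $L_{i,x}[Y]$, $Y\ne X$, of every leaf block $L_{i,x}$. The resulting graph is $G_m$. -}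

module Defs where

open import Data.Nat using (ℕ; zero; suc; _+_; _≡ᵇ_)
open import Data.Nat.DivMod using (_mod_)
open import Data.Bool using (Bool; true; false; _∧_; _∨_; not; T)
open import Data.Fin using (Fin; toℕ)
open import Data.List using (List; length; filterᵇ; cartesianProduct; allFin)
open import Data.Product using (_×_; _,_)
open import Relation.Binary.PropositionalEquality using (_≡_)
open import Function.Definitions using (Injective)

-- Letters a,b,c,d,e (also used for the uppercase labels A,...,E of leaf blocks:
-- the uppercase X of a lowercase x is the same constructor).
data Letter : Set where
  a b c d e : Letter

_==L_ : Letter → Letter → Bool
a ==L a = true
b ==L b = true
c ==L c = true
d ==L d = true
e ==L e = true
_ ==L _ = false

cyc5 : Letter → Letter → Bool
cyc5 a b = true
cyc5 b c = true
cyc5 c d = true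
cyc5 d e = true
cyc5 e a = true
cyc5 b a = true
cyc5 c b = true
cyc5 d c = true
cyc5 e d = true
cyc5 a e = true
cyc5 _ _ = false

inSet4abde : Letter → Bool
inSet4abde c = false
inSet4abde _ = true

inSet3bde : Letter → Bool
inSet3bde b = true
inSet3bde d = true
inSet3bde e = true
inSet3bde _ = false

inSet4bcde : Letter → Bool
inSet4bcde a = false
inSet4bcde _ = true

-- Does the leaf block L_{i,x} exist in G_m?  (i ranges over 0..m; m ≥ 1 assumed)
leafOK : ℕ → ℕ → Letter → Bool
leafOK m zero x = inSet4abde x
leafOK m (suc i) x with suc i ≡ᵇ m
... | true  = inSet4bcde x
... | false = inSet3bde x

data V (m : ℕ) : Set where
  sp  : Fin (suc m) → Letter → V m
  lf  : (i : Fin (suc m)) (x : Letter) → T (leafOK m (toℕ i) x) → Letter → V m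
  hub : V m

adj : {m : ℕ} → V m → V m → Bool
adj (sp i x) (sp j y) =
  ((toℕ i ≡ᵇ toℕ j) ∧ cyc5 x y)
  ∨ ((x ==L c) ∧ (y ==L a) ∧ (toℕ j ≡ᵇ suc (toℕ i)))
  ∨ ((x ==L a) ∧ (y ==L c) ∧ (toℕ i ≡ᵇ suc (toℕ j)))
adj (sp i x) (lf j y _ Y) = (toℕ i ≡ᵇ toℕ j) ∧ (x ==L y) ∧ (Y ==L y)
adj (lf j y _ Y) (sp i x) = (toℕ i ≡ᵇ toℕ j) ∧ (x ==L y) ∧ (Y ==L y)
adj (lf i x _ X) (lf j y _ Y) = (toℕ i ≡ᵇ toℕ j) ∧ (x ==L y) ∧ cyc5 X Y
adj hub (lf _ x _ Y) = not (Y ==L x)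
adj (lf _ x _ Y) hub = not (Y ==L x)
adj _ _ = false

next : {k : ℕ} → Fin (3 + k) → Fin (3 + k)
next {k} i = suc (toℕ i) mod (3 + k)

record Cycle (m : ℕ) : Set where
  field
    len    : ℕ
    vtx    : Fin (3 + len) → V m
    inj    : Injective _≡_ _≡_ vtx
    closed : (j : Fin (3 + len)) → adj (vtx j) (vtx (next j)) ≡ true

_==F_ : {n : ℕ} → Fin n → Fin n → Bool
i ==F j = toℕ i ≡ᵇ toℕ j

_<ᵇF_ : {n : ℕ} → Fin n → Fin n → Bool
i <ᵇF j = Data.Nat._<ᵇ_ (toℕ i) (toℕ j)
  where import Data.Nat

ch : {m : ℕ} → Cycle m → ℕ
ch {m} C = length (filterᵇ isChord (cartesianProduct (allFin n) (allFin n)))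
  where
    open Cycle C
    n = 3 + len
    isChord : Fin n × Fin n → Bool
    isChord (j , k) = (j <ᵇF k) ∧ adj (vtx j) (vtx k)
                      ∧ not (next j ==F k) ∧ not (next k ==F j)

-- The hub-neighbours L_{i,x}[Y] (Y ≠ X) and the spine vertices S_i[b], S_i[d],
-- S_i[e] have degree 3, so each is the end of at most one chord of a cycle C.
-- Every chord inside a 5-cycle block has such an end, and there C must leave the
-- block through the third neighbour (v, resp. the leaf block L_{i,x}). The edges
-- of G_m − v between blocks are bridges of G_m − v, so they are never chords, and
-- C can leave a leaf block only through v. Hence every chord has an end, its key,
-- in S_i[x] + L_{i,x} − L_{i,x}[X] for a leaf block L_{i,x} containing one of the
-- two C-neighbours of v. Distinct chords have distinct keys, and there are at
-- most 2 · 5 candidates.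
module Submission where

open import Defs
open import Data.Bool using (Bool; true; false; T; T?; not; _∧_)
open import Data.Bool.Properties using (T-∧; T-∨; T-≡; T-not-≡; T-irrelevant)
open import Data.Empty using (⊥-elim)
open import Data.Fin using (Fin; toℕ; join; splitAt; #_) renaming (zero to fzero; suc to fsuc)
open import Data.Fin.Properties using (toℕ-injective; toℕ-fromℕ<; toℕ<n; splitAt-join; injective⇒≤)
  renaming (_≟_ to _≟F_)
open import Data.List using (List; []; _∷_; length; lookup; filterᵇ)
open import Data.List.Membership.Propositional.Properties using (∈-lookup; ∈-filter⁻)
open import Data.List.Relation.Unary.All using (All; []; _∷_)
import Data.List.Relation.Unary.All as All
open import Data.List.Relation.Unary.AllPairs using ([]; _∷_)
open import Data.List.Relation.Unary.Unique.Propositional using (Unique)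
open import Data.List.Relation.Unary.Unique.Propositional.Properties
  using (filter⁺; cartesianProduct⁺; allFin⁺)
open import Data.Nat using (ℕ; zero; suc; _+_; _∸_; _<_; _≤_; _≤?_; _≡ᵇ_; s≤s)
open import Data.Nat.DivMod
  using (_%_; _mod_; m%n<n; m<n⇒m%n≡m; m%n%n≡m%n; %-distribˡ-+; %-remove-+ˡ; %-remove-+ʳ; n%n≡0)
open import Data.Nat.Divisibility using (∣-refl)
open import Data.Nat.Properties
  using (≡ᵇ⇒≡; ≡⇒≡ᵇ; <ᵇ⇒<; +-suc; +-identityʳ; +-assoc; m+[n∸m]≡n; <⇒≤; m≤n⇒m<n∨m≡n; ≤-pred; m≢1+n+m;
         1+n≰n; ≮⇒≥; ≤-antisym; ≤-trans; n≤1+n; ≤-refl; <-asym)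
open import Data.Product using (_×_; _,_; proj₁; proj₂; ∃)
open import Data.Sum using (_⊎_; inj₁; inj₂; assocˡ)
import Data.Sum as Sum
open import Data.Sum.Properties using (inj₁-injective; inj₂-injective)
open import Data.Vec using (Vec; []; _∷_)
import Data.Vec as Vec
open import Function using (id; _∘_; case_of_)
open import Function.Bundles using (Equivalence)
open import Function.Definitions using (Injective)
open import Level using (_⊔_; 0ℓ)
open import Relation.Binary.Definitions using (DecidableEquality)
open import Relation.Binary.PropositionalEquality
open import Relation.Nullary using (¬_; ¬?; yes; no; _because_; contradiction)
open import Relation.Nullary.Decidable using (decidable-stable)
open import Relation.Nullary.Reflects using (Reflects; ofʸ; ofⁿ)
open import Relation.Unary using (Pred; Decidable; ｛_｝; _∪_)
open import Relation.Unary.Properties using (_∪?_)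

open Equivalence using (to; from)

-- Cyclic order on Fin (3 + k)

module _ {k : ℕ} where

  private
    N : ℕ
    N = 3 + k

  prev : Fin N → Fin N
  prev j = (2 + k + toℕ j) mod N

  private
    toℕ-mod : ∀ n → toℕ (n mod N) ≡ n % N
    toℕ-mod n = toℕ-fromℕ< (m%n<n n N)

    mod-toℕ : (j : Fin N) → toℕ j mod N ≡ j
    mod-toℕ j = toℕ-injective (trans (toℕ-mod (toℕ j)) (m<n⇒m%n≡m (toℕ<n j)))

    mod-absorb : ∀ m n → (m + toℕ (n mod N)) mod N ≡ (m + n) mod N
    mod-absorb m n = toℕ-injective (begin
      toℕ ((m + toℕ (n mod N)) mod N)  ≡⟨ toℕ-mod (m + toℕ (n mod N)) ⟩
      (m + toℕ (n mod N)) % N          ≡⟨ cong (λ r → (m + r) % N) (toℕ-mod n) ⟩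
      (m + n % N) % N                  ≡⟨ %-distribˡ-+ m (n % N) N ⟩
      (m % N + n % N % N) % N          ≡⟨ cong (λ r → (m % N + r) % N) (m%n%n≡m%n n N) ⟩
      (m % N + n % N) % N              ≡⟨ sym (%-distribˡ-+ m n N) ⟩
      (m + n) % N                      ≡⟨ sym (toℕ-mod (m + n)) ⟩
      toℕ ((m + n) mod N)              ∎)
      where open ≡-Reasoning

    N+-mod : ∀ n → (N + n) mod N ≡ n mod N
    N+-mod n = toℕ-injective (trans (toℕ-mod (N + n)) (trans (%-remove-+ˡ n (∣-refl {N})) (sym (toℕ-mod n))))

    2+n%N≢n : ∀ n → n < N → (2 + n) % N ≢ n
    2+n%N≢n n n<N with m≤n⇒m<n∨m≡n (≤-pred n<N)
    ... | inj₂ refl = λ 1+N%N≡n → contradiction (trans (sym (%-remove-+ʳ 1 (∣-refl {N}))) 1+N%N≡n) λ ()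
    ... | inj₁ n<2+k with m≤n⇒m<n∨m≡n (≤-pred n<2+k)
    ...   | inj₂ refl = λ N%N≡n → contradiction (trans (sym (n%n≡0 N)) N%N≡n) λ ()
    ...   | inj₁ n<1+k = λ eq → m≢1+n+m n (sym (trans (sym (m<n⇒m%n≡m (s≤s (s≤s n<1+k)))) eq))

  next-mod : ∀ n → next (n mod N) ≡ suc n mod N
  next-mod = mod-absorb 1

  next-prev : (j : Fin N) → next (prev j) ≡ j
  next-prev j = trans (next-mod (2 + k + toℕ j)) (trans (N+-mod (toℕ j)) (mod-toℕ j))

  prev-next : (j : Fin N) → prev (next j) ≡ j
  prev-next j = begin
    (2 + k + toℕ (suc (toℕ j) mod N)) mod N  ≡⟨ mod-absorb (2 + k) (suc (toℕ j)) ⟩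
    (2 + k + suc (toℕ j)) mod N              ≡⟨ cong (λ r → suc (suc r) mod N) (+-suc k (toℕ j)) ⟩
    (N + toℕ j) mod N                        ≡⟨ N+-mod (toℕ j) ⟩
    toℕ j mod N                              ≡⟨ mod-toℕ j ⟩
    j                                        ∎
    where open ≡-Reasoning

  next∘next≢id : (j : Fin N) → next (next j) ≢ j
  next∘next≢id j eq = 2+n%N≢n (toℕ j) (toℕ<n j) (begin
    (2 + toℕ j) % N                ≡⟨ sym (toℕ-mod (2 + toℕ j)) ⟩
    toℕ (suc (suc (toℕ j)) mod N)  ≡⟨ cong toℕ (sym (next-mod (suc (toℕ j)))) ⟩
    toℕ (next (next j))            ≡⟨ cong toℕ eq ⟩
    toℕ j                          ∎)
    where open ≡-Reasoning

  descent : ∀ {ℓ} {P : Pred (Fin N) ℓ} → Decidable P → ∀ {t f} → P t → ¬ P f →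
            ∃ λ j → P j × ¬ P (next j)
  descent {P = P} P? {t} {f} Pt ¬Pf = walk (N ∸ toℕ t + toℕ f) (subst (¬_ ∘ P) (sym reach) ¬Pf)
    where
    open ≡-Reasoning
    reach : (toℕ t + (N ∸ toℕ t + toℕ f)) mod N ≡ f
    reach = begin
      (toℕ t + (N ∸ toℕ t + toℕ f)) mod N  ≡⟨ cong (_mod N) (sym (+-assoc (toℕ t) (N ∸ toℕ t) (toℕ f))) ⟩
      (toℕ t + (N ∸ toℕ t) + toℕ f) mod N  ≡⟨ cong (λ r → (r + toℕ f) mod N) (m+[n∸m]≡n (<⇒≤ (toℕ<n t))) ⟩
      (N + toℕ f) mod N                    ≡⟨ N+-mod (toℕ f) ⟩
      toℕ f mod N                          ≡⟨ mod-toℕ f ⟩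
      f                                    ∎
    walk : ∀ n → ¬ P ((toℕ t + n) mod N) → ∃ λ j → P j × ¬ P (next j)
    walk zero ¬P = contradiction (subst P (sym (trans (cong (_mod N) (+-identityʳ (toℕ t))) (mod-toℕ t))) Pt) ¬P
    walk (suc n) ¬P with P? ((toℕ t + n) mod N)
    ... | no ¬Pj = walk n ¬Pj
    ... | yes Pj = _ , Pj , subst (¬_ ∘ P) next≡ ¬P
      where
      next≡ : (toℕ t + suc n) mod N ≡ next ((toℕ t + n) mod N)
      next≡ = sym (trans (next-mod (toℕ t + n)) (cong (_mod N) (sym (+-suc (toℕ t) n))))

  ascent : ∀ {ℓ} {P : Pred (Fin N) ℓ} → Decidable P → ∀ {t f} → ¬ P t → P f →
           ∃ λ j → ¬ P j × P (next j)
  ascent P? ¬Pt Pf =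
    let (j , ¬Pj , ¬¬Pnj) = descent (¬? ∘ P?) ¬Pt (λ ¬Pf → ¬Pf Pf)
    in j , ¬Pj , decidable-stable (P? _) ¬¬Pnj

-- Counting by injections into Fin n

record AtMost {a ℓ} {A : Set a} (n : ℕ) (P : Pred A ℓ) : Set (a ⊔ ℓ) where
  field
    code           : ∀ {x} → P x → Fin n
    code-injective : ∀ {x y} (px : P x) (py : P y) → code px ≡ code py → x ≡ y

module _ {a} {A : Set a} where

  atMost-｛｝ : (u : A) → AtMost 1 ｛ u ｝
  atMost-｛｝ u = record { code = λ _ → fzero ; code-injective = λ u≡x u≡y _ → trans (sym u≡x) u≡y }

  atMost-∪ : ∀ {ℓ₁ ℓ₂ m n} {P : Pred A ℓ₁} {Q : Pred A ℓ₂} →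
             AtMost m P → AtMost n Q → AtMost (m + n) (P ∪ Q)
  atMost-∪ {m = m} {n} {P} {Q} AP AQ = record { code = join m n ∘ split ; code-injective = injective }
    where
    open AtMost
    split : ∀ {x} → (P ∪ Q) x → Fin m ⊎ Fin n
    split = Sum.map (code AP) (code AQ)
    split-injective : ∀ {x y} (px : (P ∪ Q) x) (py : (P ∪ Q) y) → split px ≡ split py → x ≡ y
    split-injective (inj₁ px) (inj₁ py) eq = code-injective AP px py (inj₁-injective eq)
    split-injective (inj₂ qx) (inj₂ qy) eq = code-injective AQ qx qy (inj₂-injective eq)
    split-injective (inj₁ _)  (inj₂ _)  ()
    split-injective (inj₂ _)  (inj₁ _)  ()
    injective : ∀ {x y} (px : (P ∪ Q) x) (py : (P ∪ Q) y) →
                join m n (split px) ≡ join m n (split py) → x ≡ y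
    injective px py eq = split-injective px py
      (trans (sym (splitAt-join m n (split px))) (trans (cong (splitAt m) eq) (splitAt-join m n (split py))))

  lookup-injective : ∀ {xs : List A} → Unique xs → ∀ {i j} → lookup xs i ≡ lookup xs j → i ≡ j
  lookup-injective (_ ∷ _)   {fzero}  {fzero}  _  = refl
  lookup-injective (x≢ ∷ _)  {fzero}  {fsuc j} eq = contradiction eq (All.lookup x≢ (∈-lookup j))
  lookup-injective (x≢ ∷ _)  {fsuc i} {fzero}  eq = contradiction (sym eq) (All.lookup x≢ (∈-lookup i))
  lookup-injective (_ ∷ uxs) {fsuc i} {fsuc j} eq = cong fsuc (lookup-injective uxs eq)

  unique⇒length≤ : ∀ {ℓ n} {P : Pred A ℓ} {xs : List A} →
                   Unique xs → All P xs → AtMost n P → length xs ≤ n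
  unique⇒length≤ {P = P} {xs} uxs pxs AP =
    injective⇒≤ {f = code ∘ proof} λ eq → lookup-injective uxs (code-injective (proof _) (proof _) eq)
    where
    open AtMost AP
    proof : ∀ i → P (lookup xs i)
    proof i = All.lookup pxs (∈-lookup {xs = xs} i)

  filterᵇ-length≤ : ∀ {ℓ n} {P : Pred A ℓ} {p : A → Bool} {xs : List A} →
                    Unique xs → (∀ {x} → T (p x) → P x) → AtMost n P → length (filterᵇ p xs) ≤ n
  filterᵇ-length≤ {p = p} {xs} uxs sound =
    unique⇒length≤ (filter⁺ (T? ∘ p) uxs)
                   (All.tabulate λ x∈ → sound (proj₂ (∈-filter⁻ (T? ∘ p) {xs = xs} x∈)))

-- Cycles in a graph

OnlyCrossing : ∀ {ℓ} {A : Set} → (A → A → Set) → A → Pred A ℓ → A → A → Set ℓ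
OnlyCrossing _∼_ w P p q = ∀ {z z′} → z ∼ z′ → w ≢ z′ → P z → ¬ P z′ → z ≡ p × z′ ≡ q

module CycleProperties {A : Set} {_∼_ : A → A → Set} (∼-sym : ∀ {u w} → u ∼ w → w ∼ u)
                       {k : ℕ} (vtx : Fin (3 + k) → A) (vtx-injective : Injective _≡_ _≡_ vtx)
                       (closed : ∀ j → vtx j ∼ vtx (next j)) where

  private
    N : ℕ
    N = 3 + k

  closed-prev : ∀ j → vtx j ∼ vtx (prev j)
  closed-prev j = ∼-sym (subst (λ i → vtx (prev j) ∼ vtx i) (next-prev j) (closed (prev j)))

  next≢prev : ∀ j → vtx (next j) ≢ vtx (prev j)
  next≢prev j eq = next∘next≢id j (trans (cong next (vtx-injective eq)) (next-prev j))

  record Chord (j k : Fin N) : Set where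
    field
      edge     : vtx j ∼ vtx k
      not-next : next j ≢ k
      not-prev : next k ≢ j

    next≢partner : vtx (next j) ≢ vtx k
    next≢partner = not-next ∘ vtx-injective

    prev≢partner : vtx (prev j) ≢ vtx k
    prev≢partner eq = not-prev (trans (cong next (sym (vtx-injective eq))) (next-prev j))

  Chord-sym : ∀ {j k} → Chord j k → Chord k j
  Chord-sym ch = record { edge = ∼-sym edge ; not-next = not-prev ; not-prev = not-next }
    where open Chord ch

  module _ {j : Fin N} {u₁ u₂ u₃ : A}
           (nbrs : ∀ {w} → vtx j ∼ w → (｛ u₁ ｝ ∪ ｛ u₂ ｝ ∪ ｛ u₃ ｝) w) where

    chord-partner-unique : ∀ {k k′} → Chord j k → Chord j k′ → k ≡ k′
    chord-partner-unique {k} {k′} ch ch′ with k ≟F k′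
    ... | yes k≡k′ = k≡k′
    ... | no k≢k′ = contradiction (unique⇒length≤ distinct in-nbrs three) 1+n≰n
      where
      open Chord
      distinct : Unique (vtx (next j) ∷ vtx (prev j) ∷ vtx k ∷ vtx k′ ∷ [])
      distinct = (next≢prev j ∷ next≢partner ch ∷ next≢partner ch′ ∷ [])
               ∷ (prev≢partner ch ∷ prev≢partner ch′ ∷ [])
               ∷ (k≢k′ ∘ vtx-injective ∷ [])
               ∷ []
               ∷ []
      in-nbrs : All (｛ u₁ ｝ ∪ ｛ u₂ ｝ ∪ ｛ u₃ ｝) (vtx (next j) ∷ vtx (prev j) ∷ vtx k ∷ vtx k′ ∷ [])
      in-nbrs = nbrs (closed j) ∷ nbrs (closed-prev j) ∷ nbrs (edge ch) ∷ nbrs (edge ch′) ∷ []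
      three : AtMost 3 (｛ u₁ ｝ ∪ ｛ u₂ ｝ ∪ ｛ u₃ ｝)
      three = atMost-∪ (atMost-｛｝ u₁) (atMost-∪ (atMost-｛｝ u₂) (atMost-｛｝ u₃))

    chord-forces-third : ∀ {k} → Chord j k → (｛ u₁ ｝ ∪ ｛ u₂ ｝) (vtx k) →
                         u₃ ≡ vtx (next j) ⊎ u₃ ≡ vtx (prev j)
    chord-forces-third {k} ch k∈ with assocˡ (nbrs (closed j)) | assocˡ (nbrs (closed-prev j))
    ... | inj₂ u₃≡     | _            = inj₁ u₃≡
    ... | inj₁ _       | inj₂ u₃≡     = inj₂ u₃≡
    ... | inj₁ next∈   | inj₁ prev∈   =
      contradiction (unique⇒length≤ distinct (next∈ ∷ prev∈ ∷ k∈ ∷ []) two) 1+n≰n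
      where
      open Chord
      distinct : Unique (vtx (next j) ∷ vtx (prev j) ∷ vtx k ∷ [])
      distinct = (next≢prev j ∷ next≢partner ch ∷ []) ∷ (prev≢partner ch ∷ []) ∷ [] ∷ []
      two : AtMost 2 (｛ u₁ ｝ ∪ ｛ u₂ ｝)
      two = atMost-∪ (atMost-｛｝ u₁) (atMost-｛｝ u₂)

  module _ {ℓ} {w : A} (w? : Decidable ｛ w ｝) {P : Pred A ℓ} (P? : Decidable P) where

    -- The cycle leaves P at one position and re-enters it at another; these two
    -- crossings cannot both use the edge pq, since then next∘next would fix a position.
    exit-via : ∀ {p q} → OnlyCrossing _∼_ w P p q → ∀ {t f} → P (vtx t) → ¬ P (vtx f) →
               ∃ λ h → w ≡ vtx h × (P (vtx (next h)) ⊎ P (vtx (prev h)))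
    exit-via {p} {q} only {t} {f} Pt ¬Pf
      with descent (P? ∘ vtx) Pt ¬Pf | ascent (P? ∘ vtx) ¬Pf Pt
    ... | j , Pj , ¬Pnj | i , ¬Pi , Pni with w? (vtx (next j)) | w? (vtx i)
    ...   | yes w≡ | _      = next j , w≡ , inj₂ (subst (P ∘ vtx) (sym (prev-next j)) Pj)
    ...   | no _   | yes w≡ = i , w≡ , inj₁ Pni
    ...   | no w≢nj | no w≢i = contradiction (trans (cong next nj≡i) (sym j≡ni)) (next∘next≢id j)
      where
      out : vtx j ≡ p × vtx (next j) ≡ q
      out = only (closed j) w≢nj Pj ¬Pnj
      back : vtx (next i) ≡ p × vtx i ≡ q
      back = only (∼-sym (closed i)) w≢i Pni ¬Pi
      nj≡i : next j ≡ i
      nj≡i = vtx-injective (trans (proj₂ out) (sym (proj₂ back)))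
      j≡ni : j ≡ next i
      j≡ni = vtx-injective (trans (proj₁ out) (sym (proj₁ back)))

    -- If pq were a chord, the cycle could leave P ∪ {w} only right after w, and enter
    -- P only right after w: the successor of w would lie both outside and inside P.
    crossing-not-chord : ∀ {p q} → OnlyCrossing _∼_ w P p q → w ≢ q →
                         ∀ {jp jq} → vtx jp ≡ p → vtx jq ≡ q → P p → ¬ P q → ¬ Chord jp jq
    crossing-not-chord only w≢q {jp} {jq} ep eq Pp ¬Pq ch =
      let (h , w≡h , ¬Pnh) = leave
          (h′ , w≡h′ , Pnh′) = enter
      in ¬Pnh (subst (P ∘ vtx ∘ next) (vtx-injective (trans (sym w≡h′) w≡h)) Pnh′)
      where
      open Chord ch
      leave : ∃ λ h → w ≡ vtx h × ¬ P (vtx (next h))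
      leave with descent ((P? ∪? w?) ∘ vtx) {jp} {jq} (inj₁ (subst P (sym ep) Pp))
                   (Sum.[ ¬Pq ∘ subst P eq , w≢q ∘ (λ w≡ → trans w≡ eq) ]′)
      ... | h , inj₂ w≡ , ¬P⁺ = h , w≡ , ¬P⁺ ∘ inj₁
      ... | j , inj₁ Pj , ¬P⁺ =
        let (j≡p , nj≡q) = only (closed j) (¬P⁺ ∘ inj₂) Pj (¬P⁺ ∘ inj₁)
        in contradiction (trans (cong next (sym (vtx-injective (trans j≡p (sym ep)))))
                                (vtx-injective (trans nj≡q (sym eq)))) not-next
      enter : ∃ λ h → w ≡ vtx h × P (vtx (next h))
      enter with ascent (P? ∘ vtx) {jq} {jp} (¬Pq ∘ subst P eq) (subst P (sym ep) Pp)
      ... | j , ¬Pj , Pnj with w? (vtx j)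
      ...   | yes w≡ = j , w≡ , Pnj
      ...   | no w≢ =
        let (nj≡p , j≡q) = only (∼-sym (closed j)) w≢ Pnj ¬Pj
        in contradiction (trans (cong next (sym (vtx-injective (trans j≡q (sym eq)))))
                                (vtx-injective (trans nj≡p (sym ep)))) not-prev

Letter-elim : {P : Letter → Set} → P a → P b → P c → P d → P e → ∀ x → P x
Letter-elim pa _  _  _  _  a = pa
Letter-elim _  pb _  _  _  b = pb
Letter-elim _  _  pc _  _  c = pc
Letter-elim _  _  _  pd _  d = pd
Letter-elim _  _  _  _  pe e = pe

==L-reflects : ∀ x y → Reflects (x ≡ y) (x ==L y)
==L-reflects a = Letter-elim (ofʸ refl) (ofⁿ λ ()) (ofⁿ λ ()) (ofⁿ λ ()) (ofⁿ λ ())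
==L-reflects b = Letter-elim (ofⁿ λ ()) (ofʸ refl) (ofⁿ λ ()) (ofⁿ λ ()) (ofⁿ λ ())
==L-reflects c = Letter-elim (ofⁿ λ ()) (ofⁿ λ ()) (ofʸ refl) (ofⁿ λ ()) (ofⁿ λ ())
==L-reflects d = Letter-elim (ofⁿ λ ()) (ofⁿ λ ()) (ofⁿ λ ()) (ofʸ refl) (ofⁿ λ ())
==L-reflects e = Letter-elim (ofⁿ λ ()) (ofⁿ λ ()) (ofⁿ λ ()) (ofⁿ λ ()) (ofʸ refl)

_≟L_ : DecidableEquality Letter
x ≟L y = (x ==L y) because ==L-reflects x y

==L⇒≡ : ∀ {x y} → T (x ==L y) → x ≡ y
==L⇒≡ {x} {y} t with x ==L y | ==L-reflects x y
... | true | ofʸ x≡y = x≡y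

not-==L⇒≢ : ∀ {x y} → T (not (x ==L y)) → x ≢ y
not-==L⇒≢ {x} {y} t with x ==L y | ==L-reflects x y
... | false | ofⁿ x≢y = x≢y

prevLetter nextLetter : Letter → Letter
prevLetter a = e
prevLetter b = a
prevLetter c = b
prevLetter d = c
prevLetter e = d
nextLetter a = b
nextLetter b = c
nextLetter c = d
nextLetter d = e
nextLetter e = a

cyc5-sym : ∀ x y → T (cyc5 x y) → T (cyc5 y x)
cyc5-sym a = Letter-elim id id id id id
cyc5-sym b = Letter-elim id id id id id
cyc5-sym c = Letter-elim id id id id id
cyc5-sym d = Letter-elim id id id id id
cyc5-sym e = Letter-elim id id id id id

cyc5-irrefl : ∀ x → ¬ T (cyc5 x x)
cyc5-irrefl a ()
cyc5-irrefl b ()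
cyc5-irrefl c ()
cyc5-irrefl d ()
cyc5-irrefl e ()

cyc5-neighbours : ∀ x y → T (cyc5 x y) → y ≡ prevLetter x ⊎ y ≡ nextLetter x
cyc5-neighbours a = Letter-elim (λ ()) (λ _ → inj₂ refl) (λ ()) (λ ()) (λ _ → inj₁ refl)
cyc5-neighbours b = Letter-elim (λ _ → inj₁ refl) (λ ()) (λ _ → inj₂ refl) (λ ()) (λ ())
cyc5-neighbours c = Letter-elim (λ ()) (λ _ → inj₁ refl) (λ ()) (λ _ → inj₂ refl) (λ ())
cyc5-neighbours d = Letter-elim (λ ()) (λ ()) (λ _ → inj₁ refl) (λ ()) (λ _ → inj₂ refl)
cyc5-neighbours e = Letter-elim (λ _ → inj₂ refl) (λ ()) (λ ()) (λ _ → inj₁ refl) (λ ())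

bde-endpoint : ∀ x y → T (cyc5 x y) → T (inSet3bde x) ⊎ T (inSet3bde y)
bde-endpoint a = Letter-elim (λ ()) (λ _ → inj₂ _) (λ ()) (λ ()) (λ _ → inj₂ _)
bde-endpoint b = λ _ _ → inj₁ _
bde-endpoint c = Letter-elim (λ ()) (λ _ → inj₂ _) (λ ()) (λ _ → inj₂ _) (λ ())
bde-endpoint d = λ _ _ → inj₁ _
bde-endpoint e = λ _ _ → inj₁ _

bde-leafOK : ∀ m i {x} → T (inSet3bde x) → T (leafOK m i x)
bde-leafOK m zero {b} _ = _
bde-leafOK m zero {d} _ = _
bde-leafOK m zero {e} _ = _
bde-leafOK m (suc i) {x} bde with suc i ≡ᵇ m
... | false = bde
... | true  = bde⊆bcde x bde
  where
  bde⊆bcde : ∀ x → T (inSet3bde x) → T (inSet4bcde x)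
  bde⊆bcde b _ = _
  bde⊆bcde d _ = _
  bde⊆bcde e _ = _

letters : Vec Letter 5
letters = a ∷ b ∷ c ∷ d ∷ e ∷ []

letterIndex : Letter → Fin 5
letterIndex a = # 0
letterIndex b = # 1
letterIndex c = # 2
letterIndex d = # 3
letterIndex e = # 4

lookup-letterIndex : ∀ x → Vec.lookup letters (letterIndex x) ≡ x
lookup-letterIndex = Letter-elim refl refl refl refl refl

letterIndex-injective : Injective _≡_ _≡_ letterIndex
letterIndex-injective {x} {y} eq =
  trans (sym (lookup-letterIndex x)) (trans (cong (Vec.lookup letters) eq) (lookup-letterIndex y))

-- The graph G_m

data Edge {m : ℕ} : V m → V m → Set where
  spine   : ∀ i {x y} → T (cyc5 x y) → Edge (sp i x) (sp i y)
  link    : ∀ {i j} → toℕ j ≡ suc (toℕ i) → Edge (sp i c) (sp j a)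
  link⁻   : ∀ {i j} → toℕ j ≡ suc (toℕ i) → Edge (sp j a) (sp i c)
  bridge  : ∀ i x p → Edge (sp i x) (lf i x p x)
  bridge⁻ : ∀ i x p → Edge (lf i x p x) (sp i x)
  leaf    : ∀ i x p {Y Z} → T (cyc5 Y Z) → Edge (lf i x p Y) (lf i x p Z)
  spoke   : ∀ i x p {Y} → Y ≢ x → Edge hub (lf i x p Y)
  spoke⁻  : ∀ i x p {Y} → Y ≢ x → Edge (lf i x p Y) hub

Edge-sym : ∀ {m} {u w : V m} → Edge u w → Edge w u
Edge-sym (spine i t)       = spine i (cyc5-sym _ _ t)
Edge-sym (link eq)         = link⁻ eq
Edge-sym (link⁻ eq)        = link eq
Edge-sym (bridge i x p)    = bridge⁻ i x p
Edge-sym (bridge⁻ i x p)   = bridge i x p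
Edge-sym (leaf i x p t)    = leaf i x p (cyc5-sym _ _ t)
Edge-sym (spoke i x p ne)  = spoke⁻ i x p ne
Edge-sym (spoke⁻ i x p ne) = spoke i x p ne

module _ {m : ℕ} where

  private
    ≡ᵇ⇒≡-Fin : {i j : Fin (suc m)} → T (toℕ i ≡ᵇ toℕ j) → i ≡ j
    ≡ᵇ⇒≡-Fin = toℕ-injective ∘ ≡ᵇ⇒≡ _ _

    ∧₃ : ∀ {p q r} → T (p ∧ q ∧ r) → T p × T q × T r
    ∧₃ t = let (tp , tqr) = T-∧ .to t in tp , T-∧ .to tqr

    spine′ : ∀ {i j x y} → i ≡ j → T (cyc5 x y) → Edge {m} (sp i x) (sp j y)
    spine′ refl = spine _

    link′ : ∀ {i j x y} → x ≡ c → y ≡ a → toℕ j ≡ suc (toℕ i) → Edge {m} (sp i x) (sp j y)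
    link′ refl refl = link

    bridge′ : ∀ {i j x y p Y} → i ≡ j → x ≡ y → Y ≡ y → Edge {m} (sp i x) (lf j y p Y)
    bridge′ refl refl refl = bridge _ _ _

    leaf′ : ∀ {i j x y p q X Y} → i ≡ j → x ≡ y → T (cyc5 X Y) → Edge {m} (lf i x p X) (lf j y q Y)
    leaf′ {p = p} {q} refl refl t with refl ← T-irrelevant p q = leaf _ _ _ t

  adj⇒Edge : (u w : V m) → T (adj u w) → Edge u w
  adj⇒Edge (sp i x) (sp j y) t with T-∨ .to t
  ... | inj₁ t′ = let (i=j , x∼y) = T-∧ .to t′ in spine′ (≡ᵇ⇒≡-Fin i=j) x∼y
  ... | inj₂ t′ with T-∨ .to t′
  ...   | inj₁ t″ = let (x=c , y=a , j=1+i) = ∧₃ t″ in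
                    link′ (==L⇒≡ x=c) (==L⇒≡ y=a) (≡ᵇ⇒≡ _ _ j=1+i)
  ...   | inj₂ t″ = let (x=a , y=c , i=1+j) = ∧₃ t″ in
                    Edge-sym (link′ (==L⇒≡ y=c) (==L⇒≡ x=a) (≡ᵇ⇒≡ _ _ i=1+j))
  adj⇒Edge (sp i x) (lf j y p Y) t =
    let (i=j , x=y , Y=y) = ∧₃ t in bridge′ (≡ᵇ⇒≡-Fin i=j) (==L⇒≡ x=y) (==L⇒≡ Y=y)
  adj⇒Edge (lf j y p Y) (sp i x) t =
    let (i=j , x=y , Y=y) = ∧₃ t in Edge-sym (bridge′ (≡ᵇ⇒≡-Fin i=j) (==L⇒≡ x=y) (==L⇒≡ Y=y))
  adj⇒Edge (lf i x p X) (lf j y q Y) t =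
    let (i=j , x=y , X∼Y) = ∧₃ t in leaf′ (≡ᵇ⇒≡-Fin i=j) (==L⇒≡ x=y) X∼Y
  adj⇒Edge hub (lf i x p Y) t = spoke i x p (not-==L⇒≢ t)
  adj⇒Edge (lf i x p Y) hub t = spoke⁻ i x p (not-==L⇒≢ t)
  adj⇒Edge (sp _ _) hub ()
  adj⇒Edge hub (sp _ _) ()
  adj⇒Edge hub hub ()

  hub? : Decidable ｛ hub {m} ｝
  hub? (sp _ _)     = no λ ()
  hub? (lf _ _ _ _) = no λ ()
  hub? hub          = yes refl

  leaf-nbrs : ∀ {i x p Y} → Y ≢ x → ∀ {w} → Edge {m} (lf i x p Y) w →
              (｛ lf i x p (prevLetter Y) ｝ ∪ ｛ lf i x p (nextLetter Y) ｝ ∪ ｛ hub ｝) w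
  leaf-nbrs Y≢x (bridge⁻ _ _ _) = contradiction refl Y≢x
  leaf-nbrs _ (leaf _ _ _ {Y} {Z} t) with cyc5-neighbours Y Z t
  ... | inj₁ refl = inj₁ refl
  ... | inj₂ refl = inj₂ (inj₁ refl)
  leaf-nbrs _ (spoke⁻ _ _ _ _) = inj₂ (inj₂ refl)

  spine-nbrs : ∀ {i U} (bde : T (inSet3bde U)) → ∀ {w} → Edge {m} (sp i U) w →
               (｛ sp i (prevLetter U) ｝ ∪ ｛ sp i (nextLetter U) ｝ ∪
                ｛ lf i U (bde-leafOK m (toℕ i) bde) U ｝) w
  spine-nbrs _ (spine _ {U} {W} t) with cyc5-neighbours U W t
  ... | inj₁ refl = inj₁ refl
  ... | inj₂ refl = inj₂ (inj₁ refl)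
  spine-nbrs () (link _)
  spine-nbrs () (link⁻ _)
  spine-nbrs _ (bridge _ _ p) = inj₂ (inj₂ (cong (λ q → lf _ _ q _) (T-irrelevant _ p)))

  data InLeaf (i : Fin (suc m)) (x : Letter) : Pred (V m) 0ℓ where
    inLeaf : ∀ p Y → InLeaf i x (lf i x p Y)

  inLeaf? : ∀ i x → Decidable (InLeaf i x)
  inLeaf? i x (sp _ _) = no λ ()
  inLeaf? i x hub      = no λ ()
  inLeaf? i x (lf j y p Y) with i ≟F j | x ≟L y
  ... | yes refl | yes refl = yes (inLeaf p Y)
  ... | no i≢j   | _        = no λ { (inLeaf _ _) → i≢j refl }
  ... | yes _    | no x≢y   = no λ { (inLeaf _ _) → x≢y refl }

  InLeaf-block : ∀ {i x i′ x′ z} → InLeaf i x z → InLeaf i′ x′ z → i ≡ i′ × x ≡ x′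
  InLeaf-block (inLeaf _ _) (inLeaf _ _) = refl , refl

  InLeaf-leafOK : ∀ {i x z} → InLeaf i x z → T (leafOK m (toℕ i) x)
  InLeaf-leafOK (inLeaf p _) = p

  leaf-block-crossing : ∀ {i x p} → OnlyCrossing Edge hub (InLeaf i x) (lf i x p x) (sp i x)
  leaf-block-crossing (bridge⁻ _ _ q) _ (inLeaf _ _) _ = cong (λ q → lf _ _ q _) (T-irrelevant q _) , refl
  leaf-block-crossing (leaf _ _ q _) _ (inLeaf _ _) out = contradiction (inLeaf q _) out
  leaf-block-crossing (spoke⁻ _ _ _ _) hub≢ _ _ = contradiction refl hub≢

  data UpTo (n : ℕ) : Pred (V m) 0ℓ where
    spine : ∀ {i} x → toℕ i ≤ n → UpTo n (sp i x)
    leaf  : ∀ {i} x p Y → toℕ i ≤ n → UpTo n (lf i x p Y)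

  upTo? : ∀ n → Decidable (UpTo n)
  upTo? n (sp i x) with toℕ i ≤? n
  ... | yes i≤n = yes (spine x i≤n)
  ... | no i≰n  = no λ { (spine _ i≤n) → i≰n i≤n }
  upTo? n (lf i x p Y) with toℕ i ≤? n
  ... | yes i≤n = yes (leaf x p Y i≤n)
  ... | no i≰n  = no λ { (leaf _ _ _ i≤n) → i≰n i≤n }
  upTo? n hub = no λ ()

  prefix-crossing : ∀ {i j} → toℕ j ≡ suc (toℕ i) → OnlyCrossing Edge hub (UpTo (toℕ i)) (sp i c) (sp j a)
  prefix-crossing {i} {j} j≡1+i (link {i′} {j′} j′≡1+i′) _ (spine _ i′≤i) out =
    cong (λ i → sp i c) i′≡i , cong (λ j → sp j a) j′≡j
    where
    i≤i′ : toℕ i ≤ toℕ i′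
    i≤i′ = ≮⇒≥ λ i′<i → out (spine a (subst (_≤ toℕ i) (sym j′≡1+i′) i′<i))
    i′≡i : i′ ≡ i
    i′≡i = toℕ-injective (≤-antisym i′≤i i≤i′)
    j′≡j : j′ ≡ j
    j′≡j = toℕ-injective (trans j′≡1+i′ (trans (cong (suc ∘ toℕ) i′≡i) (sym j≡1+i)))
  prefix-crossing _ (spine _ _) _ (spine _ le) out = contradiction (spine _ le) out
  prefix-crossing _ (link⁻ j≡1+i) _ (spine _ j≤n) out =
    contradiction (spine c (≤-trans (n≤1+n _) (subst (_≤ _) j≡1+i j≤n))) out
  prefix-crossing _ (bridge _ _ _) _ (spine _ le) out = contradiction (leaf _ _ _ le) out
  prefix-crossing _ (bridge⁻ _ _ _) _ (leaf _ _ _ le) out = contradiction (spine _ le) out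
  prefix-crossing _ (leaf _ _ _ _) _ (leaf _ _ _ le) out = contradiction (leaf _ _ _ le) out
  prefix-crossing _ (spoke⁻ _ _ _ _) hub≢ _ _ = contradiction refl hub≢

  -- The five possible keys contributed by the leaf block L_{i,x}: its four
  -- hub-neighbours, and S_i[x] in place of the attachment vertex L_{i,x}[X].
  data InExt (i : Fin (suc m)) (x : Letter) : Pred (V m) 0ℓ where
    spine : InExt i x (sp i x)
    leaf  : ∀ p {Y} → Y ≢ x → InExt i x (lf i x p Y)

  extLetter : ∀ {i x z} → InExt i x z → Letter
  extLetter {x = x} spine = x
  extLetter (leaf _ {Y} _) = Y

  extLetter-injective : ∀ {i x z z′} (ez : InExt i x z) (ez′ : InExt i x z′) →
                        extLetter ez ≡ extLetter ez′ → z ≡ z′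
  extLetter-injective spine        spine        _    = refl
  extLetter-injective (leaf p _)   (leaf q _)   refl = cong (λ q → lf _ _ q _) (T-irrelevant p q)
  extLetter-injective spine        (leaf _ Y≢x) x≡Y  = contradiction (sym x≡Y) Y≢x
  extLetter-injective (leaf _ Y≢x) spine        Y≡x  = contradiction Y≡x Y≢x

-- Chords of a cycle of G_m

module _ {m : ℕ} (C : Cycle m) where

  open Cycle C
  open CycleProperties {_∼_ = Edge} Edge-sym vtx inj
         (λ j → adj⇒Edge (vtx j) (vtx (next j)) (T-≡ .from (closed j)))

  private
    N : ℕ
    N = 3 + len

  bridge-not-chord : ∀ {j k i x p} → vtx j ≡ sp i x → vtx k ≡ lf i x p x → ¬ Chord j k
  bridge-not-chord ej ek ch =
    crossing-not-chord hub? (inLeaf? _ _) leaf-block-crossing (λ ()) ek ej (inLeaf _ _) (λ ()) (Chord-sym ch)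

  link-not-chord : ∀ {j k i i′} → toℕ i′ ≡ suc (toℕ i) → vtx j ≡ sp i c → vtx k ≡ sp i′ a → ¬ Chord j k
  link-not-chord i′≡1+i ej ek =
    crossing-not-chord hub? (upTo? _) (prefix-crossing i′≡1+i) (λ ()) ej ek (spine c ≤-refl)
      λ { (spine _ i′≤i) → 1+n≰n (subst (_≤ _) i′≡1+i i′≤i) }

  HubNeighbourIn : Fin (suc m) → Letter → Set
  HubNeighbourIn i x = ∃ λ h → hub ≡ vtx h × (InLeaf i x (vtx (next h)) ⊎ InLeaf i x (vtx (prev h)))

  leaving-leaf-block : ∀ {i x t f} → InLeaf i x (vtx t) → ¬ InLeaf i x (vtx f) → HubNeighbourIn i x
  leaving-leaf-block in-t = exit-via hub? (inLeaf? _ _) (leaf-block-crossing {p = InLeaf-leafOK in-t}) in-t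

  KeyVertex : (Fin N → Fin N) → Pred (V m) 0ℓ
  KeyVertex side z = ∃ λ h → hub ≡ vtx h × ∃ λ i → ∃ λ x → InExt i x z × InLeaf i x (vtx (side h))

  keyLetter : ∀ {side z} → KeyVertex side z → Letter
  keyLetter (_ , _ , _ , _ , ez , _) = extLetter ez

  keyVertex-atMost : ∀ side → AtMost 5 (KeyVertex side)
  keyVertex-atMost side = record { code = letterIndex ∘ keyLetter ; code-injective = injective }
    where
    injective : ∀ {z z′} (kz : KeyVertex side z) (kz′ : KeyVertex side z′) →
                letterIndex (keyLetter kz) ≡ letterIndex (keyLetter kz′) → z ≡ z′
    injective (h , hub≡h , _ , _ , ez , near) (h′ , hub≡h′ , _ , _ , ez′ , near′) eq
      with refl ← inj (trans (sym hub≡h) hub≡h′)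
      with refl , refl ← InLeaf-block near near′
      = extLetter-injective ez ez′ (letterIndex-injective eq)

  keys-atMost : AtMost 10 (KeyVertex next ∪ KeyVertex prev)
  keys-atMost = atMost-∪ (keyVertex-atMost next) (keyVertex-atMost prev)

  keyVertex : ∀ {i x z} → InExt i x z → HubNeighbourIn i x → (KeyVertex next ∪ KeyVertex prev) z
  keyVertex ez (h , hub≡h , inj₁ near) = inj₁ (h , hub≡h , _ , _ , ez , near)
  keyVertex ez (h , hub≡h , inj₂ near) = inj₂ (h , hub≡h , _ , _ , ez , near)

  record KeyedAt (ψ o : Fin N) : Set where
    field
      key  : (KeyVertex next ∪ KeyVertex prev) (vtx ψ)
      sole : ∀ {o′} → Chord ψ o′ → o′ ≡ o

  Keyed : Fin N → Fin N → Set
  Keyed j k = KeyedAt j k ⊎ KeyedAt k j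

  nbrs-at : ∀ {ψ u} {Q : Pred (V m) 0ℓ} → vtx ψ ≡ u →
            (∀ {w} → Edge u w → Q w) → ∀ {w} → Edge (vtx ψ) w → Q w
  nbrs-at refl nbrs = nbrs

  hub-chord-keyed : ∀ {ψ o i x p Y} → Chord ψ o → vtx ψ ≡ lf i x p Y → hub ≡ vtx o → Y ≢ x → KeyedAt ψ o
  hub-chord-keyed {o = o} {i} {x} {p} {Y} ch eψ hub≡o Y≢x = record
    { key  = keyVertex (subst (InExt i x) (sym eψ) (leaf p Y≢x))
                       (leaving-leaf-block (subst (InLeaf i x) (sym eψ) (inLeaf p Y)) hub-off-leaf)
    ; sole = λ ch′ → sym (chord-partner-unique (nbrs-at eψ (leaf-nbrs Y≢x)) ch ch′)
    }
    where
    hub-off-leaf : ¬ InLeaf i x (vtx o)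
    hub-off-leaf near = case subst (InLeaf i x) (sym hub≡o) near of λ ()

  leaf-chord-keyed : ∀ {ψ o i x p Y Z} → Chord ψ o → vtx ψ ≡ lf i x p Y → vtx o ≡ lf i x p Z →
                     T (cyc5 Y Z) → Y ≢ x → KeyedAt ψ o
  leaf-chord-keyed {ψ} {o} {i} {x} {p} {Y} {Z} ch eψ eo t Y≢x = record
    { key  = key
    ; sole = λ ch′ → sym (chord-partner-unique nbrs ch ch′)
    }
    where
    nbrs : ∀ {w} → Edge (vtx ψ) w →
           (｛ lf i x p (prevLetter Y) ｝ ∪ ｛ lf i x p (nextLetter Y) ｝ ∪ ｛ hub ｝) w
    nbrs = nbrs-at eψ (leaf-nbrs Y≢x)
    o-beside : (｛ lf i x p (prevLetter Y) ｝ ∪ ｛ lf i x p (nextLetter Y) ｝) (vtx o)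
    o-beside with cyc5-neighbours Y Z t
    ... | inj₁ refl = inj₁ (sym eo)
    ... | inj₂ refl = inj₂ (sym eo)
    ez : InExt i x (vtx ψ)
    ez = subst (InExt i x) (sym eψ) (leaf p Y≢x)
    in-block : ∀ {j} → vtx j ≡ vtx ψ → InLeaf i x (vtx j)
    in-block eq = subst (InLeaf i x) (sym (trans eq eψ)) (inLeaf p Y)
    key : (KeyVertex next ∪ KeyVertex prev) (vtx ψ)
    key with chord-forces-third nbrs ch o-beside
    ... | inj₁ hub≡next = inj₂ (next ψ , hub≡next , i , x , ez , in-block (cong vtx (prev-next ψ)))
    ... | inj₂ hub≡prev = inj₁ (prev ψ , hub≡prev , i , x , ez , in-block (cong vtx (next-prev ψ)))

  spine-chord-keyed : ∀ {ψ o i U W} → Chord ψ o → vtx ψ ≡ sp i U → vtx o ≡ sp i W →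
                      T (cyc5 U W) → T (inSet3bde U) → KeyedAt ψ o
  spine-chord-keyed {ψ} {o} {i} {U} {W} ch eψ eo t bde = record
    { key  = keyVertex (subst (InExt i U) (sym eψ) spine) (leaving-leaf-block (proj₂ leaf-on-cycle) spine-off-leaf)
    ; sole = λ ch′ → sym (chord-partner-unique nbrs ch ch′)
    }
    where
    nbrs : ∀ {w} → Edge (vtx ψ) w →
           (｛ sp i (prevLetter U) ｝ ∪ ｛ sp i (nextLetter U) ｝ ∪
            ｛ lf i U (bde-leafOK m (toℕ i) bde) U ｝) w
    nbrs = nbrs-at eψ (spine-nbrs bde)
    o-beside : (｛ sp i (prevLetter U) ｝ ∪ ｛ sp i (nextLetter U) ｝) (vtx o)
    o-beside with cyc5-neighbours U W t
    ... | inj₁ refl = inj₁ (sym eo)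
    ... | inj₂ refl = inj₂ (sym eo)
    leaf-on-cycle : ∃ λ t → InLeaf i U (vtx t)
    leaf-on-cycle with chord-forces-third nbrs ch o-beside
    ... | inj₁ eq = next ψ , subst (InLeaf i U) eq (inLeaf _ U)
    ... | inj₂ eq = prev ψ , subst (InLeaf i U) eq (inLeaf _ U)
    spine-off-leaf : ¬ InLeaf i U (vtx ψ)
    spine-off-leaf near = case subst (InLeaf i U) eψ near of λ ()

  chord-keyed : ∀ {j k} → Chord j k → Keyed j k
  chord-keyed {j} {k} ch = by-edge (Chord.edge ch) refl refl
    where
    by-edge : ∀ {u w} → Edge u w → vtx j ≡ u → vtx k ≡ w → Keyed j k
    by-edge (spine _ {U} {W} t) ej ek with bde-endpoint U W t
    ... | inj₁ bde = inj₁ (spine-chord-keyed ch ej ek t bde)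
    ... | inj₂ bde = inj₂ (spine-chord-keyed (Chord-sym ch) ek ej (cyc5-sym U W t) bde)
    by-edge (link k≡1+j)    ej ek = ⊥-elim (link-not-chord k≡1+j ej ek ch)
    by-edge (link⁻ j≡1+k)   ej ek = ⊥-elim (link-not-chord j≡1+k ek ej (Chord-sym ch))
    by-edge (bridge _ _ _)  ej ek = ⊥-elim (bridge-not-chord ej ek ch)
    by-edge (bridge⁻ _ _ _) ej ek = ⊥-elim (bridge-not-chord ek ej (Chord-sym ch))
    by-edge (leaf _ x _ {Y} {Z} t) ej ek with Y ≟L x
    ... | no Y≢x   = inj₁ (leaf-chord-keyed ch ej ek t Y≢x)
    ... | yes refl = inj₂ (leaf-chord-keyed (Chord-sym ch) ek ej (cyc5-sym Y Z t) λ { refl → cyc5-irrefl Y t })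
    by-edge (spoke _ _ _ Y≢x)  ej ek = inj₂ (hub-chord-keyed (Chord-sym ch) ek (sym ej) Y≢x)
    by-edge (spoke⁻ _ _ _ Y≢x) ej ek = inj₁ (hub-chord-keyed ch ej (sym ek) Y≢x)

  keyCode : ∀ {j k} → Keyed j k → Fin 10
  keyCode (inj₁ κ) = AtMost.code keys-atMost (KeyedAt.key κ)
  keyCode (inj₂ κ) = AtMost.code keys-atMost (KeyedAt.key κ)

  keyCode-injective : ∀ {j k j′ k′} → toℕ j < toℕ k → toℕ j′ < toℕ k′ → Chord j k → Chord j′ k′ →
                      (κ : Keyed j k) (κ′ : Keyed j′ k′) → keyCode κ ≡ keyCode κ′ → (j , k) ≡ (j′ , k′)
  keyCode-injective _ _ ch ch′ (inj₁ κ) (inj₁ κ′) eq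
    with refl ← inj (AtMost.code-injective keys-atMost (KeyedAt.key κ) (KeyedAt.key κ′) eq)
    with refl ← KeyedAt.sole κ ch′ = refl
  keyCode-injective j<k j′<k′ ch ch′ (inj₁ κ) (inj₂ κ′) eq
    with refl ← inj (AtMost.code-injective keys-atMost (KeyedAt.key κ) (KeyedAt.key κ′) eq)
    with refl ← KeyedAt.sole κ (Chord-sym ch′) = contradiction j<k (<-asym j′<k′)
  keyCode-injective j<k j′<k′ ch ch′ (inj₂ κ) (inj₁ κ′) eq
    with refl ← inj (AtMost.code-injective keys-atMost (KeyedAt.key κ) (KeyedAt.key κ′) eq)
    with refl ← KeyedAt.sole κ′ (Chord-sym ch) = contradiction j<k (<-asym j′<k′)
  keyCode-injective _ _ ch ch′ (inj₂ κ) (inj₂ κ′) eq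
    with refl ← inj (AtMost.code-injective keys-atMost (KeyedAt.key κ) (KeyedAt.key κ′) eq)
    with refl ← KeyedAt.sole κ (Chord-sym ch′) = refl

  OrderedChord : Pred (Fin N × Fin N) 0ℓ
  OrderedChord (j , k) = toℕ j < toℕ k × Chord j k

  orderedChords-atMost : AtMost 10 OrderedChord
  orderedChords-atMost = record
    { code           = λ (_ , ch) → keyCode (chord-keyed ch)
    ; code-injective = λ (j<k , ch) (j′<k′ , ch′) →
                         keyCode-injective j<k j′<k′ ch ch′ (chord-keyed ch) (chord-keyed ch′)
    }

  isChord-sound : ∀ {(j , k) : Fin N × Fin N} →
                  T ((j <ᵇF k) ∧ adj (vtx j) (vtx k) ∧ not (next j ==F k) ∧ not (next k ==F j)) →
                  OrderedChord (j , k)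
  isChord-sound {j , k} t =
    let (j<k , jk , nj≢k , nk≢j) = ∧₄ t
    in <ᵇ⇒< _ _ j<k , record { edge = adj⇒Edge _ _ jk ; not-next = ≢-Fin nj≢k ; not-prev = ≢-Fin nk≢j }
    where
    ∧₄ : ∀ {p q r s} → T (p ∧ q ∧ r ∧ s) → T p × T q × T r × T s
    ∧₄ t = let (tp , tqrs) = T-∧ .to t ; (tq , trs) = T-∧ .to tqrs in tp , tq , T-∧ .to trs
    ≢-Fin : ∀ {i j : Fin N} → T (not (i ==F j)) → i ≢ j
    ≢-Fin {i} t refl = subst T (T-not-≡ .to t) (≡⇒≡ᵇ (toℕ i) (toℕ i) refl)

-- The argument never uses 1 ≤ m.
proposition4p10 : (m : ℕ) → 1 ≤ m → (C : Cycle m) → ch C ≤ 10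
proposition4p10 m _ C =
  filterᵇ-length≤ (cartesianProduct⁺ (allFin⁺ _) (allFin⁺ _)) (isChord-sound C) (orderedChords-atMost C)
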